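{- Let $X$ be a connected graph with vertices $v_1,\dots,v_n$ and $m$ edges. Orient the edges of $X$ and label them $e_1,\dots,e_m$, and label the edges of $X''$ compatibly: if $e_k$ is oriented from $v_a$ to $v_b$ in $X$, then $e_k$ denotes the edge $v_a'v_{n+b}'$ of $X''$ and $e_{m+k}$ denotes the edge $v_b'v_{n+a}'$. Write the edge adjacency matrix of $X$ (with respect to $e_1,\dots,e_m,e_1^{ -1},\dots,e_m^{ -1}$) in $m\times m$ blocks as $M=\begin{bmatrix}\mathbb{A}&\mathbb{B}\\ \mathbb{C}&\mathbb{D}\end{bmatrix}$ and put $A_0=\mathbb{A}+\mathbb{D}$, $B_0=\mathbb{B}+\mathbb{C}$; write the adjacency matrix of $L(X'')$ (rows and columns ordered $e_1,\dots,e_{2m}$) in $m\times m$ blocks as $\begin{bmatrix}\mathbb{P}&\mathbb{Q}\\ \mathbb{Q}^T&\mathbb{R}\end{bmatrix}$. Then $A_0-B_0=-(\mathbb{P}-\mathbb{Q})$.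
   Context: All graphs are finite, without loops or multiple edges. $X''=X\times K_2$ is the Kronecker product of $X$ with $K_2$; here its vertices are $v_1',\dots,v_n'$ and $v_{n+1}',\dots,v_{2n}'$, with $v_i'$ adjacent to $v_{n+j}'$ iff $v_iv_j\in E(X)$ (and no other edges). $L(Y)$ is the line graph of $Y$. For oriented edges, $e_{m+i}=e_i^{ -1}$ denotes $e_i$ with reversed direction, and $s(e),t(e)$ denote starting and terminal vertices. The edge adjacency matrix $M$ of $X$ is the $2m\times 2m$ matrix indexed by $e_1,\dots,e_{2m}$ with $M_{ij}=1$ if $t(e_i)=s(e_j)$ and $s(e_i)\neq t(e_j)$, and $0$ otherwise. -}

module Defs where

open import Data.Nat using (ℕ; _+_)
open import Data.Fin using (Fin; _≟_; _↑ˡ_; _↑ʳ_; splitAt)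
open import Data.Integer using (ℤ; 0ℤ; 1ℤ)
open import Data.Product using (Σ; ∃; _×_; _,_)
open import Data.Sum using (_⊎_; inj₁; inj₂)
open import Data.Bool using (if_then_else_; _∧_; _∨_; not)
open import Relation.Nullary using (¬_)
open import Relation.Nullary.Decidable using (⌊_⌋)
open import Relation.Binary.PropositionalEquality using (_≡_)

record Graph (n : ℕ) : Set₁ where
  field
    Adj   : Fin n → Fin n → Set
    sym   : ∀ {u v} → Adj u v → Adj v u
    irrefl : ∀ {u} → ¬ Adj u u
open Graph public

data Reach {n : ℕ} (X : Graph n) : Fin n → Fin n → Set where
  here : ∀ {u} → Reach X u u
  step : ∀ {u v w} → Adj X u v → Reach X v w → Reach X u w

Connected : ∀ {n} → Graph n → Set
Connected {n} X = ∀ (u v : Fin n) → Reach X u v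

record Orientation {n : ℕ} (X : Graph n) (m : ℕ) : Set where
  field
    src : Fin m → Fin n
    tgt : Fin m → Fin n
    isEdge : ∀ k → Adj X (src k) (tgt k)
    covers : ∀ u v → Adj X u v →
             ∃ λ k → (src k ≡ u × tgt k ≡ v) ⊎ (src k ≡ v × tgt k ≡ u)
    distinct : ∀ k l →
             ((src k ≡ src l × tgt k ≡ tgt l) ⊎ (src k ≡ tgt l × tgt k ≡ src l)) →
             k ≡ l
open Orientation public

-- Oriented edges e_1..e_{2m}, with e_{m+i} = e_i^{-1}.
s : ∀ {n m} {X : Graph n} → Orientation X m → Fin (m + m) → Fin n
s {m = m} O i with splitAt m i
... | inj₁ k = src O k
... | inj₂ k = tgt O k

t : ∀ {n m} {X : Graph n} → Orientation X m → Fin (m + m) → Fin n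
t {m = m} O i with splitAt m i
... | inj₁ k = tgt O k
... | inj₂ k = src O k

edgeAdjMatrix : ∀ {n m} {X : Graph n} → Orientation X m →
                Fin (m + m) → Fin (m + m) → ℤ
edgeAdjMatrix O i j =
  if ⌊ t O i ≟ s O j ⌋ ∧ not ⌊ s O i ≟ t O j ⌋ then 1ℤ else 0ℤ

blockA blockB blockC blockD : ∀ {n m} {X : Graph n} → Orientation X m →
                              Fin m → Fin m → ℤ
blockA {m = m} O i j = edgeAdjMatrix O (i ↑ˡ m) (j ↑ˡ m)
blockB {m = m} O i j = edgeAdjMatrix O (i ↑ˡ m) (m ↑ʳ j)
blockC {m = m} O i j = edgeAdjMatrix O (m ↑ʳ i) (j ↑ˡ m)
blockD {m = m} O i j = edgeAdjMatrix O (m ↑ʳ i) (m ↑ʳ j)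

-- X'' = X × K_2 on vertices Fin (n + n): v_i' is (i ↑ˡ n), v_{n+j}' is (n ↑ʳ j),
-- v_i' ~ v_{n+j}' iff v_i v_j ∈ E(X).
kroneckerK2 : ∀ {n} → Graph n → Graph (n + n)
kroneckerK2 {n} X = record { Adj = KAdj ; sym = ksym ; irrefl = kirr }
  where
  KAdj : Fin (n + n) → Fin (n + n) → Set
  KAdj x y with splitAt n x | splitAt n y
  ... | inj₁ i | inj₂ j = Adj X i j
  ... | inj₂ j | inj₁ i = Adj X i j
  ... | _      | _      = Data.Empty.⊥
    where import Data.Empty
  ksym : ∀ {x y} → KAdj x y → KAdj y x
  ksym {x} {y} p with splitAt n x | splitAt n y
  ... | inj₁ i | inj₂ j = p
  ... | inj₂ j | inj₁ i = p
  kirr : ∀ {x} → ¬ KAdj x x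
  kirr {x} p with splitAt n x
  ... | inj₁ i = p
  ... | inj₂ i = p

-- Compatible labelling of the edges of X'': for e_k : v_a → v_b in X,
-- e_k is the edge v_a' v_{n+b}' and e_{m+k} is v_b' v_{n+a}'.
-- end1 / end2 give the two endpoints (in Fin (n + n)) of the edge with label i.
end1 end2 : ∀ {n m} {X : Graph n} → Orientation X m → Fin (m + m) → Fin (n + n)
end1 {n} O i = s O i ↑ˡ n
end2 {n} O i = n ↑ʳ t O i

lineAdjMatrix : ∀ {n m} {X : Graph n} → Orientation X m →
                Fin (m + m) → Fin (m + m) → ℤ
lineAdjMatrix O i j =
  if not ⌊ i ≟ j ⌋ ∧
     (⌊ end1 O i ≟ end1 O j ⌋ ∨ ⌊ end1 O i ≟ end2 O j ⌋ ∨
      ⌊ end2 O i ≟ end1 O j ⌋ ∨ ⌊ end2 O i ≟ end2 O j ⌋)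
  then 1ℤ else 0ℤ

blockP blockQ blockR : ∀ {n m} {X : Graph n} → Orientation X m →
                       Fin m → Fin m → ℤ
blockP {m = m} O i j = lineAdjMatrix O (i ↑ˡ m) (j ↑ˡ m)
blockQ {m = m} O i j = lineAdjMatrix O (i ↑ˡ m) (m ↑ʳ j)
blockR {m = m} O i j = lineAdjMatrix O (m ↑ʳ i) (m ↑ʳ j)

-- Put a = s(e_i), b = t(e_i), c = s(e_j), d = t(e_j). In X'' the edge e_i joins a' and (n+b)',
-- e_{m+j} joins d' and (n+c)'. Hence Q_ij = [a = d ∨ b = c] and P_ij = [i ≠ j ∧ (a = c ∨ b = d)],
-- while A_ij + D_ij = [b = c ∧ a ≠ d] + [a = d ∧ b ≠ c] and B_ij + C_ij = [b = d ∧ a ≠ c] + [a = c ∧ b ≠ d]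
-- are indicators of exclusive disjunctions. Since X has no loops and no multiple edges,
-- a = d and b = c never hold together, and a = c, b = d hold together exactly when i = j.
-- So A + D = Q and B + C = P.
module Submission where

open import Defs
open import Data.Nat using (ℕ)
open import Data.Fin using (Fin; _≟_; _↑ˡ_; _↑ʳ_; splitAt)
open import Data.Fin.Properties using (splitAt-↑ˡ; splitAt-↑ʳ; ↑ˡ-injective; ↑ʳ-injective)
open import Data.Integer using (ℤ; _+_; _-_; -_; 0ℤ; 1ℤ)
open import Data.Integer.Properties using (+-comm; +-0-abelianGroup)
open import Algebra.Properties.AbelianGroup +-0-abelianGroup using (⁻¹-anti-homo‿-)
open import Data.Bool using (Bool; true; false; if_then_else_; _∧_; _∨_; not)
open import Data.Bool.Properties using (∨-comm)
open import Data.Sum using (inj₁; inj₂)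
open import Data.Product using (_,_)
open import Data.Empty using (⊥-elim)
open import Function.Definitions using (Injective)
open import Relation.Nullary using (Dec; yes; no; ¬_)
open import Relation.Nullary.Decidable using (⌊_⌋; isYes≗does; dec-true; dec-false)
open import Relation.Binary.PropositionalEquality
  using (_≡_; _≢_; refl; trans; cong; cong₂; subst; module ≡-Reasoning)
import Relation.Binary.PropositionalEquality as ≡

indicator : Bool → ℤ
indicator b = if b then 1ℤ else 0ℤ

continues : ∀ {n} (a b c d : Fin n) → Bool
continues a b c d = ⌊ b ≟ c ⌋ ∧ not ⌊ a ≟ d ⌋

indicator-xor : ∀ x y →
  indicator (x ∧ not y) + indicator (y ∧ not x) ≡ indicator (not (x ∧ y) ∧ (x ∨ y))
indicator-xor false false = refl
indicator-xor false true  = refl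
indicator-xor true  false = refl
indicator-xor true  true  = refl

⌊⌋-true : ∀ {a} {A : Set a} (a? : Dec A) → A → ⌊ a? ⌋ ≡ true
⌊⌋-true a? a = trans (isYes≗does a?) (dec-true a? a)

⌊⌋-false : ∀ {a} {A : Set a} (a? : Dec A) → ¬ A → ⌊ a? ⌋ ≡ false
⌊⌋-false a? ¬a = trans (isYes≗does a?) (dec-false a? ¬a)

≟-injective : ∀ {k l} {f : Fin k → Fin l} → Injective _≡_ _≡_ f →
              ∀ x y → ⌊ f x ≟ f y ⌋ ≡ ⌊ x ≟ y ⌋
≟-injective f-inj x y with x ≟ y
... | yes refl = ⌊⌋-true (_ ≟ _) refl
... | no x≢y   = ⌊⌋-false (_ ≟ _) (λ fx≡fy → x≢y (f-inj fx≡fy))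

↑ˡ≢↑ʳ : ∀ {k} (x y : Fin k) → x ↑ˡ k ≢ k ↑ʳ y
↑ˡ≢↑ʳ {k} x y eq with trans (≡.sym (splitAt-↑ˡ k x k)) (trans (cong (splitAt k) eq) (splitAt-↑ʳ k k y))
... | ()

↑ʳ≢↑ˡ : ∀ {k} (x y : Fin k) → k ↑ʳ x ≢ y ↑ˡ k
↑ʳ≢↑ˡ x y eq = ↑ˡ≢↑ʳ y x (≡.sym eq)

module _ {n m : ℕ} {X : Graph n} (O : Orientation X m) where

  s-↑ˡ : ∀ i → s O (i ↑ˡ m) ≡ src O i
  s-↑ˡ i rewrite splitAt-↑ˡ m i m = refl

  t-↑ˡ : ∀ i → t O (i ↑ˡ m) ≡ tgt O i
  t-↑ˡ i rewrite splitAt-↑ˡ m i m = refl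

  s-↑ʳ : ∀ i → s O (m ↑ʳ i) ≡ tgt O i
  s-↑ʳ i rewrite splitAt-↑ʳ m m i = refl

  t-↑ʳ : ∀ i → t O (m ↑ʳ i) ≡ src O i
  t-↑ʳ i rewrite splitAt-↑ʳ m m i = refl

  src≢tgt : ∀ k → src O k ≢ tgt O k
  src≢tgt k src≡tgt = irrefl X (subst (λ v → Adj X v (tgt O k)) src≡tgt (isEdge O k))

  same-endpoints⇔same-edge : ∀ i j → ⌊ src O i ≟ src O j ⌋ ∧ ⌊ tgt O i ≟ tgt O j ⌋ ≡ ⌊ i ≟ j ⌋
  same-endpoints⇔same-edge i j with i ≟ j
  ... | yes refl rewrite ⌊⌋-true (src O i ≟ src O i) refl = ⌊⌋-true (tgt O i ≟ tgt O i) refl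
  ... | no i≢j with src O i ≟ src O j | tgt O i ≟ tgt O j
  ...   | yes ss | yes tt = ⊥-elim (i≢j (distinct O i j (inj₁ (ss , tt))))
  ...   | yes _  | no _   = refl
  ...   | no _   | _      = refl

  no-antiparallel-edges : ∀ i j → ⌊ tgt O i ≟ src O j ⌋ ∧ ⌊ src O i ≟ tgt O j ⌋ ≡ false
  no-antiparallel-edges i j with tgt O i ≟ src O j | src O i ≟ tgt O j
  ... | yes ts | yes st with distinct O i j (inj₂ (st , ts))
  ...   | refl = ⊥-elim (src≢tgt i (≡.sym ts))
  no-antiparallel-edges i j | yes _ | no _ = refl
  no-antiparallel-edges i j | no _  | _    = refl

  edgeAdjMatrix-endpoints : ∀ x y {a b c d} → s O x ≡ a → t O x ≡ b → s O y ≡ c → t O y ≡ d →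
                            edgeAdjMatrix O x y ≡ indicator (continues a b c d)
  edgeAdjMatrix-endpoints x y refl refl refl refl = refl

  blockA-endpoints : ∀ i j → blockA O i j ≡ indicator (continues (src O i) (tgt O i) (src O j) (tgt O j))
  blockA-endpoints i j = edgeAdjMatrix-endpoints _ _ (s-↑ˡ i) (t-↑ˡ i) (s-↑ˡ j) (t-↑ˡ j)

  blockB-endpoints : ∀ i j → blockB O i j ≡ indicator (continues (src O i) (tgt O i) (tgt O j) (src O j))
  blockB-endpoints i j = edgeAdjMatrix-endpoints _ _ (s-↑ˡ i) (t-↑ˡ i) (s-↑ʳ j) (t-↑ʳ j)

  blockC-endpoints : ∀ i j → blockC O i j ≡ indicator (continues (tgt O i) (src O i) (src O j) (tgt O j))
  blockC-endpoints i j = edgeAdjMatrix-endpoints _ _ (s-↑ʳ i) (t-↑ʳ i) (s-↑ˡ j) (t-↑ˡ j)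

  blockD-endpoints : ∀ i j → blockD O i j ≡ indicator (continues (tgt O i) (src O i) (tgt O j) (src O j))
  blockD-endpoints i j = edgeAdjMatrix-endpoints _ _ (s-↑ʳ i) (t-↑ʳ i) (s-↑ʳ j) (t-↑ʳ j)

  share-endpoint : ∀ x y {a b c d} → s O x ≡ a → t O x ≡ b → s O y ≡ c → t O y ≡ d →
    (⌊ end1 O x ≟ end1 O y ⌋ ∨ ⌊ end1 O x ≟ end2 O y ⌋ ∨ ⌊ end2 O x ≟ end1 O y ⌋ ∨ ⌊ end2 O x ≟ end2 O y ⌋)
      ≡ ⌊ a ≟ c ⌋ ∨ ⌊ b ≟ d ⌋
  share-endpoint x y {a} {b} {c} {d} refl refl refl refl
    rewrite ≟-injective (λ {u} {v} → ↑ˡ-injective n u v) a c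
          | ⌊⌋-false ((a ↑ˡ n) ≟ (n ↑ʳ d)) (↑ˡ≢↑ʳ a d)
          | ⌊⌋-false ((n ↑ʳ b) ≟ (c ↑ˡ n)) (↑ʳ≢↑ˡ b c)
          | ≟-injective (λ {u} {v} → ↑ʳ-injective n u v) b d
    = refl

  blockP-endpoints : ∀ i j →
    blockP O i j ≡ indicator (not ⌊ i ≟ j ⌋ ∧ (⌊ src O i ≟ src O j ⌋ ∨ ⌊ tgt O i ≟ tgt O j ⌋))
  blockP-endpoints i j =
    cong₂ (λ same shared → indicator (not same ∧ shared))
          (≟-injective (λ {u} {v} → ↑ˡ-injective m u v) i j)
          (share-endpoint _ _ (s-↑ˡ i) (t-↑ˡ i) (s-↑ˡ j) (t-↑ˡ j))

  blockQ-endpoints : ∀ i j → blockQ O i j ≡ indicator (⌊ src O i ≟ tgt O j ⌋ ∨ ⌊ tgt O i ≟ src O j ⌋)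
  blockQ-endpoints i j =
    cong₂ (λ same shared → indicator (not same ∧ shared))
          (⌊⌋-false ((i ↑ˡ m) ≟ (m ↑ʳ j)) (↑ˡ≢↑ʳ i j))
          (share-endpoint _ _ (s-↑ˡ i) (t-↑ˡ i) (s-↑ʳ j) (t-↑ʳ j))

  blockA+blockD≡blockQ : ∀ i j → blockA O i j + blockD O i j ≡ blockQ O i j
  blockA+blockD≡blockQ i j = begin
    blockA O i j + blockD O i j
      ≡⟨ cong₂ _+_ (blockA-endpoints i j) (blockD-endpoints i j) ⟩
    indicator (x ∧ not y) + indicator (y ∧ not x)
      ≡⟨ indicator-xor x y ⟩
    indicator (not (x ∧ y) ∧ (x ∨ y))
      ≡⟨ cong (λ both → indicator (not both ∧ (x ∨ y))) (no-antiparallel-edges i j) ⟩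
    indicator (x ∨ y)
      ≡⟨ cong indicator (∨-comm x y) ⟩
    indicator (y ∨ x)
      ≡⟨ blockQ-endpoints i j ⟨
    blockQ O i j ∎
    where
    open ≡-Reasoning
    x = ⌊ tgt O i ≟ src O j ⌋
    y = ⌊ src O i ≟ tgt O j ⌋

  blockB+blockC≡blockP : ∀ i j → blockB O i j + blockC O i j ≡ blockP O i j
  blockB+blockC≡blockP i j = begin
    blockB O i j + blockC O i j
      ≡⟨ +-comm (blockB O i j) (blockC O i j) ⟩
    blockC O i j + blockB O i j
      ≡⟨ cong₂ _+_ (blockC-endpoints i j) (blockB-endpoints i j) ⟩
    indicator (x ∧ not y) + indicator (y ∧ not x)
      ≡⟨ indicator-xor x y ⟩
    indicator (not (x ∧ y) ∧ (x ∨ y))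
      ≡⟨ cong (λ both → indicator (not both ∧ (x ∨ y))) (same-endpoints⇔same-edge i j) ⟩
    indicator (not ⌊ i ≟ j ⌋ ∧ (x ∨ y))
      ≡⟨ blockP-endpoints i j ⟨
    blockP O i j ∎
    where
    open ≡-Reasoning
    x = ⌊ src O i ≟ src O j ⌋
    y = ⌊ tgt O i ≟ tgt O j ⌋

theorem3p5 : (n m : ℕ) (X : Graph n) → Connected X → (O : Orientation X m) →
    ∀ (i j : Fin m) →
      (blockA O i j + blockD O i j) - (blockB O i j + blockC O i j)
        ≡ - (blockP O i j - blockQ O i j)
theorem3p5 n m X _ O i j = begin
  (blockA O i j + blockD O i j) - (blockB O i j + blockC O i j)
    ≡⟨ cong₂ _-_ (blockA+blockD≡blockQ O i j) (blockB+blockC≡blockP O i j) ⟩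
  blockQ O i j - blockP O i j
    ≡⟨ ⁻¹-anti-homo‿- (blockP O i j) (blockQ O i j) ⟨
  - (blockP O i j - blockQ O i j) ∎
  where open ≡-Reasoning
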